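{- For every $n\geq1$ and every $w\in\{+,-\}^n$, we have $F(\mathcal{C}_w)\subset\mathcal{S}_{i(w)}$.
   Context: $\mathcal{S}_n$ is the set of permutations of $[n]=\{1,\dots,n\}$ and $\mathcal{C}_n$ is the set of cyclic permutations of $[n]$ (permutations consisting of a single $n$-cycle). A total cyclic order on a finite set $X$ is a set $Z$ of triples of distinct elements of $X$ such that: $(x,y,z)\in Z\Rightarrow (y,z,x)\in Z$; $(x,y,z)\in Z\Rightarrow (z,y,x)\notin Z$; $(x,y,z)\in Z$ and $(x,z,u)\in Z\Rightarrow (x,y,u)\in Z$; and for any three distinct $x,y,z$, either $(x,y,z)\in Z$ or $(z,y,x)\in Z$. For $\pi\in\mathcal{C}_m$ ($m\geq3$), $\zeta(\pi)$ is the total cyclic order on $[m]$ with $(i_1,i_2,i_3)\in\zeta(\pi)$ iff $i_2=\pi^k(i_1)$ and $i_3=\pi^\ell(i_1)$ for some $1\leq k<\ell\leq m-1$. The cyclic descent pattern of $\pi\in\mathcal{C}_m$ is the word $\epsilon_1\cdots\epsilon_{m-2}$ with $\epsilon_i=+$ if $(i,i+1,i+2)\in\zeta(\pi)$ and $\epsilon_i=-$ if $(i+2,i+1,i)\in\zeta(\pi)$; for $w\in\{+,-\}^{m-2}$, $\mathcal{C}_w$ is the set of $\pi\in\mathcal{C}_m$ with cyclic descent pattern $w$. The descent pattern of $\sigma\in\mathcal{S}_m$ is $\epsilon_1\cdots\epsilon_{m-1}$ with $\epsilon_i=+$ if $\sigma(i+1)>\sigma(i)$ and $-$ otherwise; $\mathcal{S}_v$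 is the set of permutations with descent pattern $v$. The involution $i$ flips the signs at even positions: $i(\epsilon_1\cdots\epsilon_n)=\epsilon'_1\cdots\epsilon'_n$, $\epsilon'_j=\epsilon_j$ ($j$ odd), $\epsilon'_j=-\epsilon_j$ ($j$ even). For a total cyclic order $Z$ and distinct $a,b$, $c_Z(a,b)=\#\{x:(a,x,b)\in Z\}$. For $m\geq3$, $\partial:\mathcal{C}_m\to\mathcal{C}_{m-1}$ deletes $m$ from the cycle: $\partial(\pi)(i)=\pi(i)$ if $\pi(i)\neq m$ and $\partial(\pi)(i)=\pi(m)$ if $\pi(i)=m$. For $\tau\in\mathcal{S}_{n-1}$ and $a\in[n]$, $D^{ -1}(\tau,a)$ is the unique $\sigma\in\mathcal{S}_n$ with $\sigma(n)=a$ and, for $i\leq n-1$, $\sigma(i)=\tau(i)$ if $\tau(i)<a$, $\sigma(i)=\tau(i)+1$ if $\tau(i)\geq a$. The map $F:\bigsqcup_{n\geq1}\mathcal{C}_{n+1}\to\bigsqcup_{n\geq1}\mathcal{S}_n$ is defined inductively: $F$ sends the unique element of $\mathcal{C}_2$ to the unique element of $\mathcal{S}_1$; for $n\geq2$ and $\pi\in\mathcal{C}_{n+1}$, let $\tilde\sigma=F(\partial(\pi))$, $\beta=c_{\zeta(\pi)}(n,n+1)$, $\alpha=n-\beta$ if $n$ is even and $\alpha=1+\beta$ if $n$ is odd, and $F(\pi)=D^{ -1}(\tilde\sigma,\alpha)$. -}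

module Defs where

open import Data.Nat using (ℕ; zero; suc; _+_; _∸_; _<ᵇ_; _≤ᵇ_; _≡ᵇ_)
open import Data.Nat.Properties using (_<?_)
open import Data.Bool using (Bool; true; false; _∧_; if_then_else_; not; T)
open import Data.Fin using (Fin; zero; suc; toℕ; fromℕ; fromℕ<; inject₁)
open import Data.List using (List; upTo; length; filterᵇ)
open import Data.Bool.ListAction using (any)
open import Data.List using () renaming (allFin to allFinL)
open import Data.Product using (∃; _×_)
open import Relation.Binary.PropositionalEquality using (_≡_)
open import Relation.Nullary using (yes; no)
open import Data.Fin.Permutation using (Permutation′; _⟨$⟩ʳ_)

-- Conventions: the paper's [m] = {1,…,m} is represented by Fin m, the paper's
-- element i corresponding to the Fin element with toℕ = i - 1.

iter : ∀ {A : Set} → (A → A) → ℕ → A → A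
iter f zero    x = x
iter f (suc k) x = f (iter f k x)

-- π ∈ 𝒞_m : π is a permutation of [m] consisting of a single m-cycle,
-- i.e. every element lies in the orbit of every element.
IsCyclic : ∀ {m} → Permutation′ m → Set
IsCyclic {m} π = ∀ (i j : Fin m) → ∃ λ k → iter (π ⟨$⟩ʳ_) k i ≡ j

_==_ : ∀ {m} → Fin m → Fin m → Bool
a == b = toℕ a ≡ᵇ toℕ b

zeta : ∀ {m} → (Fin m → Fin m) → Fin m → Fin m → Fin m → Bool
zeta {m} f a b c =
  any (λ l → any (λ k → (1 ≤ᵇ k) ∧ (iter f k a == b) ∧ (iter f l a == c)) (upTo l))
      (upTo m)

cZ : ∀ {m} → (Fin m → Fin m) → Fin m → Fin m → ℕ
cZ {m} f a b = length (filterᵇ (λ x → zeta f a x b) (allFinL m))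

data Sign : Set where
  plus minus : Sign

-- π ∈ 𝒞_w for w ∈ {+,-}^n, π a cyclic permutation of [n+2]:
-- position j (paper's j+1) concerns the elements j, j+1, j+2 (0-indexed).
HasCycDescPattern : ∀ {n} → (Fin (suc (suc n)) → Fin (suc (suc n))) → (Fin n → Sign) → Set
HasCycDescPattern {n} f w = ∀ (j : Fin n) →
  (w j ≡ plus  → T (zeta f (inject₁ (inject₁ j)) (suc (inject₁ j)) (suc (suc j)))) ×
  (w j ≡ minus → T (zeta f (suc (suc j)) (suc (inject₁ j)) (inject₁ (inject₁ j))))

descPat : ∀ {n} → (Fin (suc n) → Fin (suc n)) → Fin n → Sign
descPat σ j = if toℕ (σ (inject₁ j)) <ᵇ toℕ (σ (suc j)) then plus else minus

even : ℕ → Bool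
even zero    = true
even (suc k) = not (even k)

-- the involution i: flip signs at even (1-indexed) positions,
-- i.e. at 0-indexed positions j with toℕ j odd.
flipS : Sign → Sign
flipS plus  = minus
flipS minus = plus

iInv : ∀ {n} → (Fin n → Sign) → Fin n → Sign
iInv w j = if even (toℕ j) then w j else flipS (w j)

-- convert an ℕ to Fin (suc k), clamping (clamping never occurs in uses below)
clamp : (k : ℕ) → ℕ → Fin (suc k)
clamp k x with x <? suc k
... | yes p = fromℕ< p
... | no  _ = fromℕ k

-- ∂ : delete the largest element (paper's m) from the cycle.
-- (on raw functions; the fall-back case of clamp never occurs for cyclic π with m ≥ 2)
∂ : ∀ {m} → (Fin (suc m) → Fin (suc m)) → Fin m → Fin m
∂ {m} f i with f (inject₁ i) == fromℕ m
... | true  = clamp' (f (fromℕ m))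
  where clamp' : Fin (suc m) → Fin m
        clamp' y with toℕ y <? m
        ... | yes p = fromℕ< p
        ... | no  _ = i
... | false = clamp'' (f (inject₁ i))
  where clamp'' : Fin (suc m) → Fin m
        clamp'' y with toℕ y <? m
        ... | yes p = fromℕ< p
        ... | no  _ = i

Dinv : ∀ {k} → (Fin k → Fin k) → Fin (suc k) → Fin (suc k) → Fin (suc k)
Dinv {k} τ a i with toℕ i <? k
... | no  _ = a
... | yes p = if toℕ (τ (fromℕ< p)) <ᵇ toℕ a then inject₁ (τ (fromℕ< p)) else suc (τ (fromℕ< p))

-- F : 𝒞_{m+2} → 𝒮_{m+1}  (paper's n = m+1), on the underlying functions.
F : (m : ℕ) → (Fin (suc (suc m)) → Fin (suc (suc m))) → Fin (suc m) → Fin (suc m)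
F zero     π = λ _ → zero
F (suc m') π = Dinv (F m' (∂ π)) α
  where
    -- paper's n = m' + 2; paper's elements n, n+1 are 0-indexed m'+1, m'+2
    β : ℕ
    β = cZ π (inject₁ (fromℕ (suc m'))) (fromℕ (suc (suc m')))
    -- α (1-indexed) = n - β if n even, 1 + β if n odd; here 0-indexed
    α : Fin (suc (suc m'))
    α = if even m' then clamp (suc m') ((suc m') ∸ β) else clamp (suc m') β

-- F(π) is F(∂π) with the value α appended and the values ≥ α shifted up by one;
-- the shift preserves every comparison among the first n − 1 values, so by
-- induction on n only the last sign, F(∂π)(n − 1) against α, is new. Both values
-- are determined by counts along the cycle: α by β = c(n, n + 1) in π, and
-- F(∂π)(n − 1) by β′ = c(n − 1, n) in ∂π. If n and n + 1 are reached from n − 1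
-- after p and q steps, then β + 1 = q − p and β′ + 1 = p when (n − 1, n, n + 1)
-- is positively oriented, and β + 1 = (n + 1) + q − p, β′ + 1 = p − 1 otherwise.
-- So β + β′ ≤ n − 2 in the first case and β + β′ ≥ n − 1, β ≥ 1 in the second,
-- which decides the last sign according to the parity of n.

module Submission where

open import Defs
open import Data.Nat using (ℕ; zero; suc; _+_; _∸_; _≤_; _<_; z≤n; s≤s; s≤s⁻¹; z<s; _<ᵇ_; _≤ᵇ_)
open import Data.Nat.Properties
open import Data.Bool using (Bool; true; false; _∧_; if_then_else_; T)
open import Data.Bool.Properties using (T-∧)
open import Data.Unit using (tt)
open import Data.Empty using (⊥-elim)
open import Data.Product using (∃; Σ; _×_; _,_; proj₁; proj₂)
open import Data.Sum using (_⊎_; inj₁; inj₂)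
open import Data.Fin using (Fin; zero; suc; toℕ; fromℕ; fromℕ<; inject₁)
open import Data.Fin.Properties
  using (toℕ-injective; toℕ<n; toℕ-fromℕ<; toℕ-fromℕ; toℕ-inject₁; inject₁ℕ<; fromℕ≢inject₁; inject₁-injective; pigeonhole; injective⇒≤)
open import Data.Fin.Permutation using (Permutation′; permutation; _⟨$⟩ʳ_)
open import Data.List using (length; filterᵇ; tabulate)
open import Data.List.Relation.Unary.Any.Properties using (any⁺; any⁻)
open import Data.List.Membership.Propositional using (find; lose)
open import Data.List.Membership.Propositional.Properties using (∈-upTo⁺; ∈-upTo⁻)
open import Algebra.Properties.CommutativeMonoid.Sum +-0-commutativeMonoid
  using (sum; sum-permute; sum-cong-≗; sum-replicate-zero)
open import Function.Base using (_∘_; id)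
open import Function.Bundles using (Injection; module Equivalence)
open import Function.Properties.Inverse using (↔⇒↣)
open import Relation.Binary.PropositionalEquality
open import Relation.Binary.Definitions using (tri<; tri≈; tri>)
open import Relation.Nullary using (yes; no)

open ≡-Reasoning

iter-suc : ∀ {A : Set} (f : A → A) k x → iter f (suc k) x ≡ iter f k (f x)
iter-suc f zero    x = refl
iter-suc f (suc k) x = cong f (iter-suc f k x)

iter-+ : ∀ {A : Set} (f : A → A) k l x → iter f (k + l) x ≡ iter f k (iter f l x)
iter-+ f zero    l x = refl
iter-+ f (suc k) l x = cong f (iter-+ f k l x)

iter-comm : ∀ {A : Set} (f : A → A) k l x → iter f k (iter f l x) ≡ iter f l (iter f k x)
iter-comm f k l x = trans (sym (iter-+ f k l x)) (trans (cong (λ i → iter f i x) (+-comm k l)) (iter-+ f l k x))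

iter-∸ : ∀ {A : Set} (f : A → A) {k l x} → k ≤ l → iter f (l ∸ k) (iter f k x) ≡ iter f l x
iter-∸ f {k} {l} {x} k≤l = trans (sym (iter-+ f (l ∸ k) k x)) (cong (λ i → iter f i x) (m∸n+n≡m k≤l))

≡⇒T== : ∀ {m} {a b : Fin m} → a ≡ b → T (a == b)
≡⇒T== {a = a} {b} a≡b = ≡⇒≡ᵇ (toℕ a) (toℕ b) (cong toℕ a≡b)

T==⇒≡ : ∀ {m} {a b : Fin m} → T (a == b) → a ≡ b
T==⇒≡ {a = a} {b} t = toℕ-injective (≡ᵇ⇒≡ (toℕ a) (toℕ b) t)

T-extensional : ∀ {x y} → (T x → T y) → (T y → T x) → x ≡ y
T-extensional {true}  {true}  _ _ = refl
T-extensional {true}  {false} x⇒y _ = ⊥-elim (x⇒y tt)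
T-extensional {false} {true}  _ y⇒x = ⊥-elim (y⇒x tt)
T-extensional {false} {false} _ _ = refl

1≤∧<⇒T : ∀ {k p} → 1 ≤ k × k < p → T ((1 ≤ᵇ k) ∧ (k <ᵇ p))
1≤∧<⇒T (1≤k , k<p) = Equivalence.from T-∧ (≤⇒≤ᵇ 1≤k , <⇒<ᵇ k<p)

T⇒1≤∧< : ∀ {k p} → T ((1 ≤ᵇ k) ∧ (k <ᵇ p)) → 1 ≤ k × k < p
T⇒1≤∧< {k} {p} t with 1≤k , k<p ← Equivalence.to T-∧ t = ≤ᵇ⇒≤ 1 k 1≤k , <ᵇ⇒< k p k<p

indicator : Bool → ℕ
indicator true  = 1
indicator false = 0

length-filterᵇ-tabulate : ∀ {n} {A : Set} (p : A → Bool) (g : Fin n → A) →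
  length (filterᵇ p (tabulate g)) ≡ sum (indicator ∘ p ∘ g)
length-filterᵇ-tabulate {zero}  p g = refl
length-filterᵇ-tabulate {suc n} p g with p (g zero)
... | true  = cong suc (length-filterᵇ-tabulate p (g ∘ suc))
... | false = length-filterᵇ-tabulate p (g ∘ suc)

count-< : ∀ {n} K → K ≤ n → sum {n} (λ k → indicator (toℕ k <ᵇ K)) ≡ K
count-< {n}     zero    _         = sum-replicate-zero n
count-< {suc n} (suc K) (s≤s K≤n) = cong suc (count-< K K≤n)

count-positive-< : ∀ {n} K → K < n → sum {n} (λ k → indicator ((1 ≤ᵇ toℕ k) ∧ (toℕ k <ᵇ suc K))) ≡ K
count-positive-< {suc n} K (s≤s K≤n) = count-< K K≤n

record Ordered {m} (f : Fin m → Fin m) (a b c : Fin m) : Set where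
  constructor ordered
  field
    {k l} : ℕ
    1≤k   : 1 ≤ k
    k<l   : k < l
    l<m   : l < m
    iterᵏ : iter f k a ≡ b
    iterˡ : iter f l a ≡ c

zeta⁺ : ∀ {m} {f : Fin m → Fin m} {a b c} → Ordered f a b c → T (zeta f a b c)
zeta⁺ (ordered 1≤k k<l l<m eb ec) =
  any⁺ _ (lose (∈-upTo⁺ l<m) (any⁺ _ (lose (∈-upTo⁺ k<l)
    (Equivalence.from T-∧ (≤⇒≤ᵇ 1≤k , Equivalence.from T-∧ (≡⇒T== eb , ≡⇒T== ec))))))

zeta⁻ : ∀ {m} {f : Fin m → Fin m} {a b c} → T (zeta f a b c) → Ordered f a b c
zeta⁻ t
  with l , l∈ , tˡ ← find (any⁻ _ _ t)
  with k , k∈ , tᵏ ← find (any⁻ _ _ tˡ)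
  with 1≤k , eqs ← Equivalence.to T-∧ tᵏ
  with eb , ec ← Equivalence.to T-∧ eqs
  = ordered (≤ᵇ⇒≤ 1 k 1≤k) (∈-upTo⁻ k∈) (∈-upTo⁻ l∈) (T==⇒≡ eb) (T==⇒≡ ec)

record SingleCycle {N} (f : Fin N → Fin N) : Set where
  field
    reach          : ∀ a b → Σ ℕ λ k → k < N × iter f k a ≡ b
    iter-injective : ∀ a {k l} → k < N → l < N → iter f k a ≡ iter f l a → k ≡ l

  pos : Fin N → Fin N → ℕ
  pos a b = proj₁ (reach a b)

  pos<N : ∀ a b → pos a b < N
  pos<N a b = proj₁ (proj₂ (reach a b))

  iter-pos : ∀ a b → iter f (pos a b) a ≡ b
  iter-pos a b = proj₂ (proj₂ (reach a b))

  pos-unique : ∀ {a b k} → k < N → iter f k a ≡ b → pos a b ≡ k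
  pos-unique {a} {b} k<N e = iter-injective a (pos<N a b) k<N (trans (iter-pos a b) (sym e))

module SingleCycleProperties {N} {f : Fin N → Fin N} (c : SingleCycle f) where
  open SingleCycle c

  iter-suc-pos : ∀ a → iter f (suc (pos (f a) a)) a ≡ a
  iter-suc-pos a = trans (iter-suc f (pos (f a) a) a) (iter-pos (f a) a)

  iter-N : ∀ a → iter f N a ≡ a
  iter-N a with m≤n⇒m<n∨m≡n (pos<N (f a) a)
  ... | inj₁ 1+k<N = ⊥-elim (1+n≢0 (iter-injective a 1+k<N (≤-trans z<s 1+k<N) (iter-suc-pos a)))
  ... | inj₂ 1+k≡N = subst (λ n → iter f n a ≡ a) 1+k≡N (iter-suc-pos a)

  rotate : ∀ {a b c} → Ordered f a b c → Ordered f b c a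
  rotate {a} (ordered {k} {l} 1≤k k<l l<N refl refl) = ordered
    (m<n⇒0<n∸m k<l) (∸-monoˡ-< l<N (<⇒≤ k<l)) (∸-monoʳ-< 1≤k k≤N)
    (iter-∸ f (<⇒≤ k<l)) (trans (iter-∸ f k≤N) (iter-N a))
    where k≤N = <⇒≤ (<-trans k<l l<N)

  zeta-rotate : ∀ {a b c} → T (zeta f a b c) → T (zeta f b c a)
  zeta-rotate t = zeta⁺ (rotate (zeta⁻ t))

  zeta⇒pos< : ∀ {a b c} → T (zeta f a b c) → 1 ≤ pos a b × pos a b < pos a c
  zeta⇒pos< t with ordered 1≤k k<l l<N eb ec ← zeta⁻ t
    rewrite pos-unique (<-trans k<l l<N) eb | pos-unique l<N ec = 1≤k , k<l

  pos<⇒zeta : ∀ {a b c} → 1 ≤ pos a b × pos a b < pos a c → T (zeta f a b c)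
  pos<⇒zeta {a} {b} {c} (1≤p , p<q) = zeta⁺ (ordered 1≤p p<q (pos<N a c) (iter-pos a b) (iter-pos a c))

  pos-∸ : ∀ {a b c} → pos a b ≤ pos a c → pos b c ≡ pos a c ∸ pos a b
  pos-∸ {a} {b} {c} p≤q = pos-unique (≤-<-trans (m∸n≤m (pos a c) (pos a b)) (pos<N a c))
    (trans (cong (iter f (pos a c ∸ pos a b)) (sym (iter-pos a b))) (trans (iter-∸ f p≤q) (iter-pos a c)))

  pos-wrap : ∀ {a b c} → pos a c < pos a b → pos b c + pos a b ≡ pos a c + N
  pos-wrap {a} {b} {c} q<p = begin
    pos b c + p      ≡⟨ cong (_+ p) (pos-unique r<N iterʳ) ⟩
    (q + N) ∸ p + p  ≡⟨ m∸n+n≡m p≤q+N ⟩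
    q + N            ∎
    where
    p = pos a b
    q = pos a c
    p≤q+N = ≤-trans (<⇒≤ (pos<N a b)) (m≤n+m N q)
    r<N : (q + N) ∸ p < N
    r<N = subst ((q + N) ∸ p <_) (m+n∸m≡n p N) (∸-monoˡ-< (+-monoˡ-< N q<p) p≤q+N)
    iterʳ : iter f ((q + N) ∸ p) b ≡ c
    iterʳ = trans (cong (iter f ((q + N) ∸ p)) (sym (iter-pos a b)))
      (trans (iter-∸ f p≤q+N) (trans (iter-+ f q N a) (trans (cong (iter f q) (iter-N a)) (iter-pos a c))))

  ≢⇒1≤pos : ∀ {a b} → a ≢ b → 1 ≤ pos a b
  ≢⇒1≤pos {a} {b} a≢b with pos a b | iter-pos a b
  ... | zero  | a≡b = ⊥-elim (a≢b a≡b)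
  ... | suc _ | _   = s≤s z≤n

  pos-injective : ∀ {a b c} → pos a b ≡ pos a c → b ≡ c
  pos-injective {a} {b} {c} e = trans (sym (iter-pos a b)) (trans (cong (λ i → iter f i a) e) (iter-pos a c))

  orbit : Fin N → Permutation′ N
  orbit a = permutation (λ k → iter f (toℕ k) a) (λ b → fromℕ< (pos<N a b))
    (λ b → trans (cong (λ k → iter f k a) (toℕ-fromℕ< (pos<N a b))) (iter-pos a b))
    (λ k → toℕ-injective (trans (toℕ-fromℕ< (pos<N a _)) (pos-unique (toℕ<n k) refl)))

  zeta-orbit : ∀ a b k → zeta f a (iter f (toℕ k) a) b ≡ (1 ≤ᵇ toℕ k) ∧ (toℕ k <ᵇ pos a b)
  zeta-orbit a b k = T-extensional
    (1≤∧<⇒T ∘ subst (λ i → 1 ≤ i × i < pos a b) posᵏ ∘ zeta⇒pos<)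
    (pos<⇒zeta ∘ subst (λ i → 1 ≤ i × i < pos a b) (sym posᵏ) ∘ T⇒1≤∧<)
    where posᵏ = pos-unique {a} {iter f (toℕ k) a} (toℕ<n k) refl

  suc-cZ : ∀ {a b} → a ≢ b → suc (cZ f a b) ≡ pos a b
  suc-cZ {a} {b} a≢b with pos a b | pos<N a b | ≢⇒1≤pos a≢b | zeta-orbit a b
  ... | suc K | K<N | _ | zeta-orbitᵏ = cong suc (begin
    cZ f a b
      ≡⟨ length-filterᵇ-tabulate (λ x → zeta f a x b) id ⟩
    sum {N} (λ x → indicator (zeta f a x b))
      ≡⟨ sum-permute _ (orbit a) ⟩
    sum {N} (λ k → indicator (zeta f a (iter f (toℕ k) a) b))
      ≡⟨ sum-cong-≗ (cong indicator ∘ zeta-orbitᵏ) ⟩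
    sum {N} (λ k → indicator ((1 ≤ᵇ toℕ k) ∧ (toℕ k <ᵇ suc K)))
      ≡⟨ count-positive-< K (<-trans (n<1+n K) K<N) ⟩
    K ∎)

module _ {N} {f : Fin N → Fin N} (f-injective : ∀ {x y} → f x ≡ f y → x ≡ y) where

  iter-cancel : ∀ i {x y} → iter f i x ≡ iter f i y → x ≡ y
  iter-cancel zero    e = e
  iter-cancel (suc i) e = iter-cancel i (f-injective e)

  iter-period : ∀ {a i j} → i ≤ j → iter f i a ≡ iter f j a → iter f (j ∸ i) a ≡ a
  iter-period {a} {i} {j} i≤j e = iter-cancel i (begin
    iter f i (iter f (j ∸ i) a)  ≡⟨ iter-comm f i (j ∸ i) a ⟩
    iter f (j ∸ i) (iter f i a)  ≡⟨ iter-∸ f i≤j ⟩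
    iter f j a                   ≡⟨ e ⟨
    iter f i a                   ∎)

  iter-reduce : ∀ {a d} → 1 ≤ d → iter f d a ≡ a → ∀ k → Σ ℕ λ r → r < d × iter f k a ≡ iter f r a
  iter-reduce 1≤d period zero = 0 , 1≤d , refl
  iter-reduce {a} {d} 1≤d period (suc k) with iter-reduce 1≤d period k
  ... | r , r<d , e with m≤n⇒m<n∨m≡n r<d
  ...   | inj₁ 1+r<d = suc r , 1+r<d , cong f e
  ...   | inj₂ 1+r≡d = 0 , 1≤d , trans (cong f e) (trans (cong (λ i → iter f i a) 1+r≡d) period)

  module _ (cyclic : ∀ a b → ∃ λ k → iter f k a ≡ b) where

    period≤N : ∀ a → Σ ℕ λ d → 1 ≤ d × d ≤ N × iter f d a ≡ a
    period≤N a with i , j , i<j , e ← pigeonhole (n<1+n N) (λ (i : Fin (suc N)) → iter f (toℕ i) a)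
      = toℕ j ∸ toℕ i , m<n⇒0<n∸m i<j , ≤-trans (m∸n≤m (toℕ j) (toℕ i)) (s≤s⁻¹ (toℕ<n j)) ,
        iter-period (<⇒≤ i<j) e

    N≤period : ∀ {a d} → 1 ≤ d → iter f d a ≡ a → N ≤ d
    N≤period {a} {d} 1≤d period = injective⇒≤ {f = residue} residue-injective
      where
      residue : Fin N → Fin d
      residue b = fromℕ< (proj₁ (proj₂ (iter-reduce 1≤d period (proj₁ (cyclic a b)))))
      iter-residue : ∀ b → iter f (toℕ (residue b)) a ≡ b
      iter-residue b with iter-reduce 1≤d period (proj₁ (cyclic a b))
      ... | r , r<d , e = trans (cong (λ i → iter f i a) (toℕ-fromℕ< r<d)) (trans (sym e) (proj₂ (cyclic a b)))
      residue-injective : ∀ {b b′} → residue b ≡ residue b′ → b ≡ b′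
      residue-injective {b} {b′} e =
        trans (sym (iter-residue b)) (trans (cong (λ r → iter f (toℕ r) a) e) (iter-residue b′))

    no-shorter-period : ∀ a {k l} → k < l → l < N → iter f k a ≢ iter f l a
    no-shorter-period a {k} {l} k<l l<N e = <⇒≱ (≤-<-trans (m∸n≤m l k) l<N)
      (N≤period (m<n⇒0<n∸m k<l) (iter-period (<⇒≤ k<l) e))

    cyclic⇒singleCycle : SingleCycle f
    cyclic⇒singleCycle = record { reach = reach ; iter-injective = iter-injective }
      where
      reach : ∀ a b → Σ ℕ λ k → k < N × iter f k a ≡ b
      reach a b with d , 1≤d , d≤N , period ← period≤N a
                with r , r<d , e ← iter-reduce 1≤d period (proj₁ (cyclic a b))
        = r , <-≤-trans r<d d≤N , trans (sym e) (proj₂ (cyclic a b))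
      iter-injective : ∀ a {k l} → k < N → l < N → iter f k a ≡ iter f l a → k ≡ l
      iter-injective a {k} {l} k<N l<N e with <-cmp k l
      ... | tri< k<l _ _ = ⊥-elim (no-shorter-period a k<l l<N e)
      ... | tri≈ _ k≡l _ = k≡l
      ... | tri> _ _ l<k = ⊥-elim (no-shorter-period a l<k k<N (sym e))

isCyclic⇒singleCycle : ∀ {N} (π : Permutation′ N) → IsCyclic π → SingleCycle (π ⟨$⟩ʳ_)
isCyclic⇒singleCycle π = cyclic⇒singleCycle (Injection.injective (↔⇒↣ π))

punchInℕ : ℕ → ℕ → ℕ
punchInℕ q k = if k <ᵇ q then k else suc k

data PunchInℕView (q k : ℕ) : ℕ → Set where
  below : k < q → PunchInℕView q k k
  above : q ≤ k → PunchInℕView q k (suc k)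

punchInℕ-view : ∀ q k → PunchInℕView q k (punchInℕ q k)
punchInℕ-view q k with k <ᵇ q in e
... | true  = below (<ᵇ⇒< k q (subst T (sym e) tt))
... | false = above (≮⇒≥ (λ k<q → subst T e (<⇒<ᵇ k<q)))

punchInℕ-< : ∀ {q k} → k < q → punchInℕ q k ≡ k
punchInℕ-< {q} {k} k<q with punchInℕ q k | punchInℕ-view q k
... | _ | below _   = refl
... | _ | above q≤k = ⊥-elim (<⇒≱ k<q q≤k)

punchInℕ-≥ : ∀ {q k} → q ≤ k → punchInℕ q k ≡ suc k
punchInℕ-≥ {q} {k} q≤k with punchInℕ q k | punchInℕ-view q k
... | _ | below k<q = ⊥-elim (<⇒≱ k<q q≤k)
... | _ | above _   = refl

punchInℕ-below : ∀ {q k} → punchInℕ q k < q → punchInℕ q k ≡ k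
punchInℕ-below {q} {k} p<q with punchInℕ q k | punchInℕ-view q k
... | _ | below _   = refl
... | _ | above q≤k = ⊥-elim (<⇒≱ p<q (m≤n⇒m≤1+n q≤k))

punchInℕ-above : ∀ {q k} → q < punchInℕ q k → punchInℕ q k ≡ suc k
punchInℕ-above {q} {k} q<p with punchInℕ q k | punchInℕ-view q k
... | _ | below k<q = ⊥-elim (<-asym k<q q<p)
... | _ | above _   = refl

punchInℕ-≤ : ∀ q k → punchInℕ q k ≤ suc k
punchInℕ-≤ q k with punchInℕ q k | punchInℕ-view q k
... | _ | below _ = n≤1+n k
... | _ | above _ = ≤-refl

punchInℕ-mono-≤ : ∀ q {k l} → k ≤ l → punchInℕ q k ≤ punchInℕ q l
punchInℕ-mono-≤ q {k} {l} k≤l with punchInℕ q k | punchInℕ-view q k | punchInℕ q l | punchInℕ-view q l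
... | _ | below _   | _ | below _   = k≤l
... | _ | below _   | _ | above _   = m≤n⇒m≤1+n k≤l
... | _ | above q≤k | _ | below l<q = ⊥-elim (<⇒≱ l<q (≤-trans q≤k k≤l))
... | _ | above _   | _ | above _   = s≤s k≤l

punchInℕ-mono-< : ∀ q {k l} → k < l → punchInℕ q k < punchInℕ q l
punchInℕ-mono-< q {k} {l} k<l with punchInℕ q k | punchInℕ-view q k | punchInℕ q l | punchInℕ-view q l
... | _ | below _   | _ | below _   = k<l
... | _ | below _   | _ | above _   = m<n⇒m<1+n k<l
... | _ | above q≤k | _ | below l<q = ⊥-elim (<⇒≱ l<q (≤-trans q≤k (<⇒≤ k<l)))
... | _ | above _   | _ | above _   = s≤s k<l

punchInℕ-cancel-< : ∀ q {k l} → punchInℕ q k < punchInℕ q l → k < l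
punchInℕ-cancel-< q {k} {l} lt = ≰⇒> (λ l≤k → <⇒≱ lt (punchInℕ-mono-≤ q l≤k))

punchInℕ-injective : ∀ q {k l} → punchInℕ q k ≡ punchInℕ q l → k ≡ l
punchInℕ-injective q {k} {l} e with <-cmp k l
... | tri< k<l _ _ = ⊥-elim (<⇒≢ (punchInℕ-mono-< q k<l) e)
... | tri≈ _ k≡l _ = k≡l
... | tri> _ _ l<k = ⊥-elim (<⇒≢ (punchInℕ-mono-< q l<k) (sym e))

punchInℕ-suc : ∀ q k → suc (punchInℕ q k) ≢ q → punchInℕ q (suc k) ≡ suc (punchInℕ q k)
punchInℕ-suc q k ≢q with punchInℕ q k | punchInℕ-view q k
... | _ | below k<q = punchInℕ-< (≤∧≢⇒< k<q ≢q)
... | _ | above q≤k = punchInℕ-≥ (m≤n⇒m≤1+n q≤k)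

punchInℕ-suc-skip : ∀ q k → suc (punchInℕ q k) ≡ q → punchInℕ q (suc k) ≡ suc (suc (punchInℕ q k))
punchInℕ-suc-skip q k ≡q with punchInℕ q k | punchInℕ-view q k
... | _ | below _   = punchInℕ-≥ (≤-reflexive (sym ≡q))
... | _ | above q≤k = ⊥-elim (<-irrefl (sym ≡q) (m≤n⇒m≤1+n (s≤s q≤k)))

punchOutℕ : ∀ {M q K} → q ≤ M → K < suc M → K ≢ q → Σ ℕ λ k → k < M × punchInℕ q k ≡ K
punchOutℕ {M} {q} {K} q≤M K<1+M K≢q with <-cmp K q
... | tri< K<q _ _ = K , <-≤-trans K<q q≤M , punchInℕ-< K<q
... | tri≈ _ K≡q _ = ⊥-elim (K≢q K≡q)
punchOutℕ {M} {q} {suc k} q≤M k<M K≢q | tri> _ _ q<K = k , s≤s⁻¹ k<M , punchInℕ-≥ (s≤s⁻¹ q<K)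

punchInℕ-positive⁻ : ∀ {q k} → 1 ≤ q → 1 ≤ punchInℕ q k → 1 ≤ k
punchInℕ-positive⁻ {q} {zero}  1≤q 1≤p = subst (1 ≤_) (punchInℕ-< 1≤q) 1≤p
punchInℕ-positive⁻ {q} {suc k} _   _   = s≤s z≤n

inject₁-fromℕ< : ∀ {M} {y : Fin (suc M)} (y<M : toℕ y < M) → inject₁ (fromℕ< y<M) ≡ y
inject₁-fromℕ< y<M = toℕ-injective (trans (toℕ-inject₁ _) (toℕ-fromℕ< y<M))

≢fromℕ⇒< : ∀ {M} {y : Fin (suc M)} → y ≢ fromℕ M → toℕ y < M
≢fromℕ⇒< {M} {y} y≢M =
  ≤∧≢⇒< (s≤s⁻¹ (toℕ<n y)) (λ e → y≢M (toℕ-injective (trans e (sym (toℕ-fromℕ M)))))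

module _ {M} (f : Fin (suc M) → Fin (suc M)) where

  ∂-inject₁ : ∀ x → f (inject₁ x) ≢ fromℕ M → inject₁ (∂ f x) ≡ f (inject₁ x)
  ∂-inject₁ x fx≢M with f (inject₁ x) == fromℕ M in eq
  ... | true = ⊥-elim (fx≢M (T==⇒≡ (subst T (sym eq) tt)))
  ... | false with toℕ (f (inject₁ x)) <? M
  ...   | yes fx<M = inject₁-fromℕ< fx<M
  ...   | no  fx≮M = ⊥-elim (fx≮M (≢fromℕ⇒< fx≢M))

  ∂-inject₁-top : ∀ x → f (inject₁ x) ≡ fromℕ M → f (fromℕ M) ≢ fromℕ M →
    inject₁ (∂ f x) ≡ f (fromℕ M)
  ∂-inject₁-top x fx≡M fM≢M with f (inject₁ x) == fromℕ M in eq
  ... | false = ⊥-elim (subst T eq (≡⇒T== fx≡M))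
  ... | true with toℕ (f (fromℕ M)) <? M
  ...   | yes fM<M = inject₁-fromℕ< fM<M
  ...   | no  fM≮M = ⊥-elim (fM≮M (≢fromℕ⇒< fM≢M))

module Deletion {M} {f : Fin (suc M) → Fin (suc M)} (c : SingleCycle f) (1≤M : 1 ≤ M) where
  open SingleCycle c
  open SingleCycleProperties c

  top : Fin (suc M)
  top = fromℕ M

  f-top≢top : f top ≢ top
  f-top≢top e with iter-injective top {1} {0} (s≤s 1≤M) (s≤s z≤n) e
  ... | ()

  gap : Fin M → ℕ
  gap a = pos (inject₁ a) top

  1≤gap : ∀ a → 1 ≤ gap a
  1≤gap a = ≢⇒1≤pos (fromℕ≢inject₁ ∘ sym)

  punchIn-gap<1+M : ∀ a {k} → k < M → punchInℕ (gap a) k < suc M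
  punchIn-gap<1+M a {k} k<M = s≤s (≤-trans (punchInℕ-≤ (gap a) k) k<M)

  -- Along the orbit of a, ∂ f takes the steps of f but skips the visit to top at step gap a.
  ∂-step : ∀ a {k y} → suc k < M → inject₁ y ≡ iter f (punchInℕ (gap a) k) (inject₁ a) →
    inject₁ (∂ f y) ≡ iter f (punchInℕ (gap a) (suc k)) (inject₁ a)
  ∂-step a {k} {y} 1+k<M y≡ with suc (punchInℕ (gap a) k) ≟ gap a
  ... | yes hits = begin
    inject₁ (∂ f y)
      ≡⟨ ∂-inject₁-top f y (trans (cong f y≡) reaches-top) f-top≢top ⟩
    f top
      ≡⟨ cong f reaches-top ⟨
    iter f (2 + punchInℕ (gap a) k) (inject₁ a)
      ≡⟨ cong (λ i → iter f i (inject₁ a)) (punchInℕ-suc-skip (gap a) k hits) ⟨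
    iter f (punchInℕ (gap a) (suc k)) (inject₁ a) ∎
    where
    reaches-top : iter f (suc (punchInℕ (gap a) k)) (inject₁ a) ≡ top
    reaches-top = trans (cong (λ i → iter f i (inject₁ a)) hits) (iter-pos (inject₁ a) top)
  ... | no misses = begin
    inject₁ (∂ f y)
      ≡⟨ ∂-inject₁ f y avoids-top ⟩
    f (inject₁ y)
      ≡⟨ cong f y≡ ⟩
    iter f (suc (punchInℕ (gap a) k)) (inject₁ a)
      ≡⟨ cong (λ i → iter f i (inject₁ a)) (punchInℕ-suc (gap a) k misses) ⟨
    iter f (punchInℕ (gap a) (suc k)) (inject₁ a) ∎
    where
    avoids-top : f (inject₁ y) ≢ top
    avoids-top e = misses (iter-injective (inject₁ a)
      (s≤s (≤-trans (s≤s (punchInℕ-≤ (gap a) k)) 1+k<M)) (pos<N (inject₁ a) top)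
      (trans (sym (cong f y≡)) (trans e (sym (iter-pos (inject₁ a) top)))))

  iter-∂ : ∀ a k → k < M → inject₁ (iter (∂ f) k a) ≡ iter f (punchInℕ (gap a) k) (inject₁ a)
  iter-∂ a zero    _     = cong (λ i → iter f i (inject₁ a)) (sym (punchInℕ-< (1≤gap a)))
  iter-∂ a (suc k) 1+k<M = ∂-step a 1+k<M (iter-∂ a k (<-trans (n<1+n k) 1+k<M))

  pos≢gap : ∀ a b → pos (inject₁ a) (inject₁ b) ≢ gap a
  pos≢gap a b e = fromℕ≢inject₁ (sym (pos-injective e))

  ∂-singleCycle : SingleCycle (∂ f)
  ∂-singleCycle = record { reach = reach∂ ; iter-injective = iter-injective∂ }
    where
    reach∂ : ∀ a b → Σ ℕ λ k → k < M × iter (∂ f) k a ≡ b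
    reach∂ a b
      with k , k<M , punchIn≡ ← punchOutℕ (s≤s⁻¹ (pos<N (inject₁ a) top)) (pos<N (inject₁ a) (inject₁ b)) (pos≢gap a b)
      = k , k<M , inject₁-injective (begin
        inject₁ (iter (∂ f) k a)                       ≡⟨ iter-∂ a k k<M ⟩
        iter f (punchInℕ (gap a) k) (inject₁ a)        ≡⟨ cong (λ i → iter f i (inject₁ a)) punchIn≡ ⟩
        iter f (pos (inject₁ a) (inject₁ b)) (inject₁ a) ≡⟨ iter-pos (inject₁ a) (inject₁ b) ⟩
        inject₁ b                                      ∎)
    iter-injective∂ : ∀ a {k l} → k < M → l < M → iter (∂ f) k a ≡ iter (∂ f) l a → k ≡ l
    iter-injective∂ a {k} {l} k<M l<M e = punchInℕ-injective (gap a)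
      (iter-injective (inject₁ a) (punchIn-gap<1+M a k<M) (punchIn-gap<1+M a l<M)
        (trans (sym (iter-∂ a k k<M)) (trans (cong inject₁ e) (iter-∂ a l l<M))))

  module ∂ = SingleCycle ∂-singleCycle
  module ∂Properties = SingleCycleProperties ∂-singleCycle

  pos-∂ : ∀ a b → pos (inject₁ a) (inject₁ b) ≡ punchInℕ (gap a) (∂.pos a b)
  pos-∂ a b = pos-unique (punchIn-gap<1+M a (∂.pos<N a b))
    (trans (sym (iter-∂ a (∂.pos a b) (∂.pos<N a b))) (cong inject₁ (∂.iter-pos a b)))

  zeta-∂ : ∀ {x y z} → T (zeta f (inject₁ x) (inject₁ y) (inject₁ z)) → T (zeta (∂ f) x y z)
  zeta-∂ {x} {y} {z} t with 1≤p , p<p′ ← zeta⇒pos< t rewrite pos-∂ x y | pos-∂ x z =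
    ∂Properties.pos<⇒zeta (punchInℕ-positive⁻ (1≤gap x) 1≤p , punchInℕ-cancel-< (gap x) p<p′)

-- descPat σ j unfolds to stepSign (toℕ (σ (inject₁ j))) (toℕ (σ (suc j))).
stepSign : ℕ → ℕ → Sign
stepSign u v = if u <ᵇ v then plus else minus

stepSign-< : ∀ {u v} → u < v → stepSign u v ≡ plus
stepSign-< {u} {v} u<v with u <ᵇ v in e
... | true  = refl
... | false = ⊥-elim (subst T e (<⇒<ᵇ u<v))

stepSign-≥ : ∀ {u v} → v ≤ u → stepSign u v ≡ minus
stepSign-≥ {u} {v} v≤u with u <ᵇ v in e
... | true  = ⊥-elim (<⇒≱ (<ᵇ⇒< u v (subst T (sym e) tt)) v≤u)
... | false = refl

stepSign-punchInℕ : ∀ q u v → stepSign (punchInℕ q u) (punchInℕ q v) ≡ stepSign u v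
stepSign-punchInℕ q u v with u <? v
... | yes u<v = trans (stepSign-< (punchInℕ-mono-< q u<v)) (sym (stepSign-< u<v))
... | no  u≮v = trans (stepSign-≥ (punchInℕ-mono-≤ q (≮⇒≥ u≮v))) (sym (stepSign-≥ (≮⇒≥ u≮v)))

stepSign-punchInℕ-pivot : ∀ q u → stepSign (punchInℕ q u) q ≡ stepSign u q
stepSign-punchInℕ-pivot q u with punchInℕ q u | punchInℕ-view q u
... | _ | below _   = refl
... | _ | above q≤u = trans (stepSign-≥ (m≤n⇒m≤1+n q≤u)) (sym (stepSign-≥ q≤u))

Dinv-fromℕ : ∀ {k} (τ : Fin k → Fin k) a → Dinv τ a (fromℕ k) ≡ a
Dinv-fromℕ {k} τ a with toℕ (fromℕ k) <? k
... | yes k<k = ⊥-elim (<-irrefl (toℕ-fromℕ k) k<k)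
... | no  _   = refl

toℕ-Dinv-inject₁ : ∀ {k} (τ : Fin k → Fin k) a i →
  toℕ (Dinv τ a (inject₁ i)) ≡ punchInℕ (toℕ a) (toℕ (τ i))
toℕ-Dinv-inject₁ {k} τ a i with toℕ (inject₁ i) <? k
... | no  i≮k = ⊥-elim (i≮k (inject₁ℕ< i))
... | yes i<k rewrite toℕ-injective {i = fromℕ< i<k} {j = i} (trans (toℕ-fromℕ< i<k) (toℕ-inject₁ i))
  with toℕ (τ i) <ᵇ toℕ a
...   | true  = toℕ-inject₁ (τ i)
...   | false = refl

descPat-Dinv-inject₁ : ∀ {k} (τ : Fin (suc k) → Fin (suc k)) a j → descPat (Dinv τ a) (inject₁ j) ≡ descPat τ j
descPat-Dinv-inject₁ τ a j = begin
  stepSign (toℕ (Dinv τ a (inject₁ (inject₁ j)))) (toℕ (Dinv τ a (inject₁ (suc j))))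
    ≡⟨ cong₂ stepSign (toℕ-Dinv-inject₁ τ a (inject₁ j)) (toℕ-Dinv-inject₁ τ a (suc j)) ⟩
  stepSign (punchInℕ (toℕ a) (toℕ (τ (inject₁ j)))) (punchInℕ (toℕ a) (toℕ (τ (suc j))))
    ≡⟨ stepSign-punchInℕ (toℕ a) _ _ ⟩
  descPat τ j ∎

descPat-Dinv-fromℕ : ∀ {k} (τ : Fin (suc k) → Fin (suc k)) a →
  descPat (Dinv τ a) (fromℕ k) ≡ stepSign (toℕ (τ (fromℕ k))) (toℕ (Dinv τ a (fromℕ (suc k))))
descPat-Dinv-fromℕ {k} τ a = begin
  stepSign (toℕ (Dinv τ a (inject₁ (fromℕ k)))) (toℕ (Dinv τ a (fromℕ (suc k))))
    ≡⟨ cong₂ stepSign (toℕ-Dinv-inject₁ τ a (fromℕ k)) (cong toℕ (Dinv-fromℕ τ a)) ⟩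
  stepSign (punchInℕ (toℕ a) (toℕ (τ (fromℕ k)))) (toℕ a)
    ≡⟨ stepSign-punchInℕ-pivot (toℕ a) _ ⟩
  stepSign (toℕ (τ (fromℕ k))) (toℕ a)
    ≡⟨ cong (λ x → stepSign (toℕ (τ (fromℕ k))) (toℕ x)) (Dinv-fromℕ τ a) ⟨
  stepSign (toℕ (τ (fromℕ k))) (toℕ (Dinv τ a (fromℕ (suc k)))) ∎

toℕ-clamp : ∀ k {x} → x ≤ k → toℕ (clamp k x) ≡ x
toℕ-clamp k {x} x≤k with x <? suc k
... | yes x<1+k = toℕ-fromℕ< x<1+k
... | no  x≮1+k = ⊥-elim (x≮1+k (s≤s x≤k))

β : ∀ m → (Fin (3 + m) → Fin (3 + m)) → ℕ
β m f = cZ f (inject₁ (fromℕ (suc m))) (fromℕ (suc (suc m)))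

-- β′ (suc m) f is β m (∂ f), the β used by F one step earlier; β′ 0 f = 0.
β′ : ∀ m → (Fin (3 + m) → Fin (3 + m)) → ℕ
β′ m f = cZ (∂ f) (inject₁ (fromℕ m)) (fromℕ (suc m))

toℕ-F-last : ∀ m (f : Fin (3 + m) → Fin (3 + m)) → β m f ≤ suc m →
  toℕ (F (suc m) f (fromℕ (suc m))) ≡ (if even m then suc m ∸ β m f else β m f)
toℕ-F-last m f β≤1+m = trans (cong toℕ (Dinv-fromℕ (F m (∂ f)) _)) (toℕ-α (even m))
  where
  toℕ-α : ∀ e → toℕ (if e then clamp (suc m) (suc m ∸ β m f) else clamp (suc m) (β m f)) ≡
                (if e then suc m ∸ β m f else β m f)
  toℕ-α true  = toℕ-clamp (suc m) (m∸n≤m (suc m) (β m f))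
  toℕ-α false = toℕ-clamp (suc m) β≤1+m

toℕ-F-∂-last : ∀ m (f : Fin (3 + m) → Fin (3 + m)) → β′ m f ≤ m →
  toℕ (F m (∂ f) (fromℕ m)) ≡ (if even m then β′ m f else m ∸ β′ m f)
toℕ-F-∂-last zero    f β′≤0   = sym (n≤0⇒n≡0 β′≤0)
toℕ-F-∂-last (suc m) f β′≤1+m rewrite toℕ-F-last m (∂ f) β′≤1+m with even m
... | true  = refl
... | false = refl

SignBound : ℕ → ℕ → ℕ → Sign → Set
SignBound m b b′ plus  = b + b′ ≤ m
SignBound m b b′ minus = suc m ≤ b + b′ × 1 ≤ b

stepSign-even : ∀ s {m b b′} → SignBound m b b′ s → stepSign b′ (suc m ∸ b) ≡ s
stepSign-even plus  {m} {b} {b′} b+b′≤m       =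
  stepSign-< (m+n≤o⇒m≤o∸n (suc b′) (s≤s (subst (_≤ m) (+-comm b b′) b+b′≤m)))
stepSign-even minus {m} {b} {b′} (m<b+b′ , _) =
  stepSign-≥ (m≤n+o⇒m∸n≤o (suc m) b m<b+b′)

stepSign-odd : ∀ s {m b b′} → SignBound m b b′ s → stepSign (m ∸ b′) b ≡ flipS s
stepSign-odd plus  {m} {b}     {b′} b+b′≤m       =
  stepSign-≥ (m+n≤o⇒m≤o∸n b b+b′≤m)
stepSign-odd minus {m} {suc b} {b′} (m<b+b′ , _) =
  stepSign-< (m<n+o⇒m∸n<o m b′ (subst (m <_) (+-comm (suc b) b′) m<b+b′))

stepSign-last : ∀ e s {m b b′} → SignBound m b b′ s →
  stepSign (if e then b′ else m ∸ b′) (if e then suc m ∸ b else b) ≡ (if e then s else flipS s)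
stepSign-last true  s = stepSign-even s
stepSign-last false s = stepSign-odd s

ascent-arithmetic : ∀ {m b b′ p q} → p ≡ suc b′ → suc b ≡ q ∸ p → p ≤ q → q < 3 + m → b + b′ ≤ m
ascent-arithmetic {m} {b} {b′} {p} {q} refl split p≤q q<N =
  s≤s⁻¹ (s≤s⁻¹ (s≤s⁻¹ (subst (_< 3 + m) 2+b+b′≡q q<N)))
  where
  2+b+b′≡q : q ≡ 2 + (b + b′)
  2+b+b′≡q = begin
    q                 ≡⟨ m∸n+n≡m p≤q ⟨
    (q ∸ p) + p       ≡⟨ cong (_+ p) split ⟨
    suc b + suc b′    ≡⟨ cong suc (+-suc b b′) ⟩
    2 + (b + b′)      ∎

descent-positive : ∀ {m b p q} → suc b + p ≡ q + (3 + m) → p < 3 + m → 1 ≤ q → 1 ≤ b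
descent-positive {b = suc _} _ _ _ = s≤s z≤n
descent-positive {m} {b = zero} wrap p<N 1≤q =
  ⊥-elim (<⇒≱ p<N (s≤s⁻¹ (subst (4 + m ≤_) (sym wrap) (+-monoˡ-≤ (3 + m) 1≤q))))

descent-arithmetic : ∀ {m b b′ p q} → p ≡ 2 + b′ → suc b + p ≡ q + (3 + m) → p < 3 + m → 1 ≤ q →
  suc m ≤ b + b′ × 1 ≤ b
descent-arithmetic {m} {b} {b′} {p} {q} refl wrap p<N 1≤q =
  subst (suc m ≤_) (sym b+b′≡q+m) (+-monoˡ-≤ m 1≤q) , descent-positive wrap p<N 1≤q
  where
  b+b′≡q+m : b + b′ ≡ q + m
  b+b′≡q+m = +-cancelˡ-≡ 3 (b + b′) (q + m) (begin
    3 + (b + b′)       ≡⟨ cong suc (trans (+-suc b (suc b′)) (cong suc (+-suc b b′))) ⟨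
    suc b + (2 + b′)   ≡⟨ wrap ⟩
    q + (3 + m)        ≡⟨ +-comm q (3 + m) ⟩
    3 + (m + q)        ≡⟨ cong (3 +_) (+-comm m q) ⟩
    3 + (q + m)        ∎)

module TopThree (m : ℕ) {f : Fin (3 + m) → Fin (3 + m)} (c : SingleCycle f) where
  open SingleCycle c
  open SingleCycleProperties c
  open Deletion c (s≤s z≤n)

  -- The paper's n − 1, n, n + 1 for n = m + 2; ∂ f deletes e₂.
  e₀ e₁ e₂ : Fin (3 + m)
  e₀ = inject₁ (inject₁ (fromℕ m))
  e₁ = inject₁ (fromℕ (suc m))
  e₂ = fromℕ (suc (suc m))

  suc-β : suc (β m f) ≡ pos e₁ e₂
  suc-β = suc-cZ (fromℕ≢inject₁ ∘ sym)

  suc-β′ : suc (β′ m f) ≡ ∂.pos (inject₁ (fromℕ m)) (fromℕ (suc m))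
  suc-β′ = ∂Properties.suc-cZ (fromℕ≢inject₁ ∘ sym)

  β≤1+m : β m f ≤ suc m
  β≤1+m = s≤s⁻¹ (s≤s⁻¹ (subst (_< 3 + m) (sym suc-β) (pos<N e₁ e₂)))

  β′≤m : β′ m f ≤ m
  β′≤m = s≤s⁻¹ (s≤s⁻¹ (subst (_< 2 + m) (sym suc-β′) (∂.pos<N _ _)))

  ascent-bound : T (zeta f e₀ e₁ e₂) → β m f + β′ m f ≤ m
  ascent-bound t = ascent-arithmetic p≡1+β′ (trans suc-β (pos-∸ (<⇒≤ p<q))) (<⇒≤ p<q) (pos<N e₀ e₂)
    where
    p<q = proj₂ (zeta⇒pos< t)
    p≡1+β′ : pos e₀ e₁ ≡ suc (β′ m f)
    p≡1+β′ = trans (pos-∂ _ _)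
      (trans (punchInℕ-below (subst (_< pos e₀ e₂) (pos-∂ _ _) p<q)) (sym suc-β′))

  descent-bound : T (zeta f e₂ e₁ e₀) → suc m ≤ β m f + β′ m f × 1 ≤ β m f
  descent-bound t = descent-arithmetic p≡2+β′ (trans (cong (_+ pos e₀ e₁) suc-β) (pos-wrap q<p)) (pos<N e₀ e₁) 1≤q
    where
    1≤q×q<p = zeta⇒pos< (zeta-rotate (zeta-rotate t))
    1≤q = proj₁ 1≤q×q<p
    q<p = proj₂ 1≤q×q<p
    p≡2+β′ : pos e₀ e₁ ≡ 2 + β′ m f
    p≡2+β′ = trans (pos-∂ _ _)
      (trans (punchInℕ-above (subst (pos e₀ e₂ <_) (pos-∂ _ _) q<p)) (cong suc (sym suc-β′)))

  sign-bound : ∀ {w : Fin (suc m) → Sign} → HasCycDescPattern f w → SignBound m (β m f) (β′ m f) (w (fromℕ m))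
  sign-bound {w} hp with w (fromℕ m) in e
  ... | plus  = ascent-bound (proj₁ (hp (fromℕ m)) e)
  ... | minus = descent-bound (proj₂ (hp (fromℕ m)) e)

  descPat-F-last : ∀ {w : Fin (suc m) → Sign} → HasCycDescPattern f w →
    descPat (F (suc m) f) (fromℕ m) ≡ iInv w (fromℕ m)
  descPat-F-last {w} hp = begin
    descPat (F (suc m) f) (fromℕ m)
      ≡⟨ descPat-Dinv-fromℕ (F m (∂ f)) _ ⟩
    stepSign (toℕ (F m (∂ f) (fromℕ m))) (toℕ (F (suc m) f (fromℕ (suc m))))
      ≡⟨ cong₂ stepSign (toℕ-F-∂-last m f β′≤m) (toℕ-F-last m f β≤1+m) ⟩
    stepSign (if even m then β′ m f else m ∸ β′ m f) (if even m then suc m ∸ β m f else β m f)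
      ≡⟨ stepSign-last (even m) (w (fromℕ m)) (sign-bound hp) ⟩
    (if even m then w (fromℕ m) else flipS (w (fromℕ m)))
      ≡⟨ cong (λ i → if even i then w (fromℕ m) else flipS (w (fromℕ m))) (toℕ-fromℕ m) ⟨
    iInv w (fromℕ m) ∎

fromℕ-or-inject₁ : ∀ {k} (j : Fin (suc k)) → j ≡ fromℕ k ⊎ Σ (Fin k) λ j′ → j ≡ inject₁ j′
fromℕ-or-inject₁ {zero}  zero    = inj₁ refl
fromℕ-or-inject₁ {suc k} zero    = inj₂ (zero , refl)
fromℕ-or-inject₁ {suc k} (suc j) with fromℕ-or-inject₁ j
... | inj₁ j≡k         = inj₁ (cong suc j≡k)
... | inj₂ (j′ , j≡j′) = inj₂ (suc j′ , cong suc j≡j′)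

∂-pattern : ∀ {n} {f : Fin (3 + n) → Fin (3 + n)} {w : Fin (suc n) → Sign} → SingleCycle f →
  HasCycDescPattern f w → HasCycDescPattern (∂ f) (w ∘ inject₁)
∂-pattern c hp j = zeta-∂ ∘ proj₁ (hp (inject₁ j)) , zeta-∂ ∘ proj₂ (hp (inject₁ j))
  where open Deletion c (s≤s z≤n)

descPat-F : ∀ m {f : Fin (3 + m) → Fin (3 + m)} (w : Fin (suc m) → Sign) → SingleCycle f →
  HasCycDescPattern f w → ∀ j → descPat (F (suc m) f) j ≡ iInv w j
descPat-F m w c hp j with fromℕ-or-inject₁ j
... | inj₁ refl = TopThree.descPat-F-last m c hp
descPat-F zero    w c hp j | inj₂ (() , _)
descPat-F (suc m) {f} w c hp j | inj₂ (j′ , refl) = begin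
  descPat (F (suc (suc m)) f) (inject₁ j′)
    ≡⟨ descPat-Dinv-inject₁ (F (suc m) (∂ f)) _ j′ ⟩
  descPat (F (suc m) (∂ f)) j′
    ≡⟨ descPat-F m (w ∘ inject₁) (Deletion.∂-singleCycle c (s≤s z≤n)) (∂-pattern c hp) j′ ⟩
  iInv (w ∘ inject₁) j′
    ≡⟨ cong (λ i → if even i then w (inject₁ j′) else flipS (w (inject₁ j′))) (toℕ-inject₁ j′) ⟨
  iInv w (inject₁ j′) ∎

lemma2 : (n : ℕ) → 1 ≤ n → (w : Fin n → Sign) →
    (π : Permutation′ (suc (suc n))) → IsCyclic π →
    HasCycDescPattern (π ⟨$⟩ʳ_) w →
    ∀ (j : Fin n) → descPat (F n (π ⟨$⟩ʳ_)) j ≡ iInv w j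
lemma2 (suc m) _ w π cyclic = descPat-F m w (isCyclic⇒singleCycle π cyclic)
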